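{- Let $\mathcal{A}$ be a finite alphabet and let $s$ be a balanced standard episturmian sequence over $\mathcal{A}$ containing at least three distinct letters. Suppose a directive sequence of $s$ is $\Delta(s)=a\,y\,a\,z$ with $a\in\mathcal{A}$, $y\in\mathcal{A}^+$ nonempty, $z\in\mathcal{A}^{\omega}$, where the letters of $ay$ are pairwise distinct (so $a$ does not occur in $y$ and $a$ is the first repeated letter of $\Delta(s)$). Then $z_i\ne y_j$ for all $i,j$.
   Context: For a finite word $w$, $w^{(+)}$ denotes the shortest palindrome having $w$ as a prefix. For an infinite word $\Delta=x_1x_2\cdots$ set $u_1=\varepsilon$, $u_{n+1}=(u_nx_n)^{(+)}$. An infinite word $s$ is standard episturmian if there exists an infinite word $\Delta$ (a directive sequence of $s$) such that every $u_n$ is a prefix of $s$. A word is balanced if for any two factors $u,v$ of the same length and every letter $b$, $||u|_b-|v|_b|\le1$, where $|u|_b$ counts occurrences of $b$ in $u$. The first repeated letter of $\Delta$ is $\Delta_j$ for the smallest $j$ with $\Delta_j=\Delta_i$ for some $i<j$. -}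

module Defs where

open import Data.Nat using (ℕ; zero; suc; _+_; _≤_; ∣_-_∣)
open import Data.Fin using (Fin; toℕ; _≟_)
open import Data.List using (List; []; _∷_; _++_; [_]; length; reverse; filter; tabulate)
open import Data.Product using (Σ; ∃; _×_)
open import Relation.Binary.PropositionalEquality using (_≡_; _≢_)

-- Infinite words over an alphabet A are functions ℕ → A (x₁x₂⋯ is x 0, x 1, …).
Word∞ : Set → Set
Word∞ A = ℕ → A

takeω : {A : Set} → ℕ → Word∞ A → List A
takeω n x = tabulate {n = n} (λ i → x (toℕ i))

factor : {A : Set} → Word∞ A → ℕ → ℕ → List A
factor x i n = takeω n (λ t → x (i + t))

_⊙_ : {A : Set} → List A → Word∞ A → Word∞ A
([] ⊙ x) n = x n
((c ∷ w) ⊙ x) zero = c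
((c ∷ w) ⊙ x) (suc n) = (w ⊙ x) n

Prefix : {A : Set} → List A → List A → Set
Prefix w q = ∃ λ t → w ++ t ≡ q

Prefixω : {A : Set} → List A → Word∞ A → Set
Prefixω w s = w ≡ takeω (length w) s

Palindrome : {A : Set} → List A → Set
Palindrome w = reverse w ≡ w

IsPalClosure : {A : Set} → List A → List A → Set
IsPalClosure w p =
  Palindrome p × Prefix w p ×
  (∀ q → Palindrome q → Prefix w q → length p ≤ length q)

-- Δ is a directive sequence of s: u₁ = ε, u_{n+1} = (u_n x_n)^(+), all u_n prefixes of s
-- (indices shifted by one: u 0 is u₁, Δ 0 is x₁)
IsDirective : {A : Set} → Word∞ A → Word∞ A → Set
IsDirective {A} Δ s =
  Σ (ℕ → List A) λ u →
    (u 0 ≡ []) ×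
    (∀ n → IsPalClosure (u n ++ [ Δ n ]) (u (suc n))) ×
    (∀ n → Prefixω (u n) s)

StandardEpisturmian : {A : Set} → Word∞ A → Set
StandardEpisturmian {A} s = Σ (Word∞ A) λ Δ → IsDirective Δ s

count : {k : ℕ} → Fin k → List (Fin k) → ℕ
count b u = length (filter (b ≟_) u)

Balanced : {k : ℕ} → Word∞ (Fin k) → Set
Balanced s = ∀ i j n b → ∣ count b (factor s i n) - count b (factor s j n) ∣ ≤ 1

AtLeastThreeLetters : {A : Set} → Word∞ A → Set
AtLeastThreeLetters s =
  ∃ λ i → ∃ λ j → ∃ λ l → (s i ≢ s j) × (s i ≢ s l) × (s j ≢ s l)

-- Write u n for the palindromic prefixes of s, so that u (n+1) = (u n Δₙ)⁽⁺⁾ and s (|u n|) = Δₙ,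
-- and let b = y_j be the letter introduced at step J = j + 1 of Δ. If z_i = b, then b recurs at a
-- later step N; since u (N+1) ends with b (u N) and u N begins with (u J) b, the factor b (u J) b
-- occurs in s, and by balance every factor of length |u J| + 2 contains b. A b-free factor of
-- that length is exhibited in each case. If a letter c ≠ b is new at a step M ≥ J, then
-- u (M+1) = (u M) c (u M), and the suffix u J of the palindrome u M followed by c a is b-free.
-- This settles J < |y| (c = Δ (J+1)) and J = 1, where a third letter of s can be introduced
-- neither at step 0 (Δ₀ = a) nor later. If J = |y| ≥ 2, then u (J+1) = (u J) b (u J) and
-- Δ (J+1) = a, and the factor (u J) a s(2|u J|+2) following the first b is b-free: were
-- s(2|u J|+2) = b, its mirror image in the palindrome u (J+2) would be the b of u (J+1), forcing
-- |u (J+2)| = 3|u J| + 3 and then y₀ = Δ₁ = s₁ = s(|u J|+2) = s(2|u J|) = s₀ = a.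

module Submission where

open import Defs
open import Data.Nat using (ℕ; zero; suc; _+_; _≤_; _<_; _≥_; z≤n; s≤s; s≤s⁻¹; ∣_-_∣)
open import Data.Nat.Properties hiding (_≟_)
open import Data.Nat.Tactic.RingSolver using (solve-∀)
open import Data.Fin as Fin using (Fin; toℕ; _≟_)
open import Data.Fin.Properties using (toℕ<n)
open import Data.List
  using (List; []; _∷_; _++_; [_]; _∷ʳ_; length; lookup; reverse; filter; applyUpTo; applyDownFrom)
open import Data.List.Properties
  using ( ∷-injective; ++-assoc; length-++; reverse-++; unfold-reverse; reverse-applyUpTo
        ; filter-none; filter-some; filter-accept)
open import Data.List.Relation.Unary.All using (All; _∷_)
open import Data.List.Relation.Unary.All.Properties using (applyUpTo⁺₁)
open import Data.List.Relation.Unary.Any.Properties using (applyUpTo⁺)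
open import Data.List.Relation.Unary.AllPairs using (_∷_)
open import Data.List.Relation.Unary.Unique.Propositional using (Unique)
open import Data.Product using (∃; _×_; _,_; proj₁; proj₂)
open import Data.Sum using (_⊎_; inj₁; inj₂)
open import Data.Empty using (⊥; ⊥-elim)
open import Function using (_∘_)
open import Relation.Nullary using (¬_; yes; no; contradiction)
open import Relation.Binary.Definitions using (tri<; tri≈; tri>)
open import Relation.Binary.PropositionalEquality
  using (_≡_; _≢_; refl; sym; trans; cong; subst; module ≡-Reasoning)

takeω≡applyUpTo : ∀ {A : Set} n (x : Word∞ A) → takeω n x ≡ applyUpTo x n
takeω≡applyUpTo zero    x = refl
takeω≡applyUpTo (suc n) x = cong (x 0 ∷_) (takeω≡applyUpTo n (x ∘ suc))

applyDownFrom≡applyUpTo⇒mirror : ∀ {A : Set} {f g : ℕ → A} {n} t {t'} →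
  applyDownFrom f n ≡ applyUpTo g n → suc (t + t') ≡ n → f t' ≡ g t
applyDownFrom≡applyUpTo⇒mirror zero    eq refl = proj₁ (∷-injective eq)
applyDownFrom≡applyUpTo⇒mirror {g = g} (suc t) eq refl =
  applyDownFrom≡applyUpTo⇒mirror {g = g ∘ suc} t (proj₂ (∷-injective eq)) refl

palindrome-mirror : ∀ {A : Set} {x : Word∞ A} {n t t'} →
  Palindrome (takeω n x) → suc (t + t') ≡ n → x t ≡ x t'
palindrome-mirror {x = x} {n} {t} pal eq = sym (applyDownFrom≡applyUpTo⇒mirror t palindrome eq)
  where
  open ≡-Reasoning
  palindrome : applyDownFrom x n ≡ applyUpTo x n
  palindrome = begin
    applyDownFrom x n        ≡⟨ reverse-applyUpTo x n ⟨
    reverse (applyUpTo x n)  ≡⟨ cong reverse (takeω≡applyUpTo n x) ⟨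
    reverse (takeω n x)      ≡⟨ pal ⟩
    takeω n x                ≡⟨ takeω≡applyUpTo n x ⟩
    applyUpTo x n            ∎

takeω≡++∷⇒letter : ∀ {A : Set} {x : Word∞ A} {n} (w : List A) {c r} →
  takeω n x ≡ w ++ c ∷ r → x (length w) ≡ c
takeω≡++∷⇒letter {n = zero}  []      ()
takeω≡++∷⇒letter {n = zero}  (_ ∷ _) ()
takeω≡++∷⇒letter {n = suc n} []      eq = proj₁ (∷-injective eq)
takeω≡++∷⇒letter {x = x} {suc n} (_ ∷ w) eq =
  takeω≡++∷⇒letter {x = x ∘ suc} w (proj₂ (∷-injective eq))

palindrome-++-∷ : ∀ {A : Set} {w : List A} c → Palindrome w → Palindrome (w ++ c ∷ w)
palindrome-++-∷ {w = w} c pal = begin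
  reverse (w ++ c ∷ w)            ≡⟨ reverse-++ w (c ∷ w) ⟩
  reverse (c ∷ w) ++ reverse w    ≡⟨ cong (_++ reverse w) (unfold-reverse c w) ⟩
  (reverse w ∷ʳ c) ++ reverse w   ≡⟨ cong (λ v → (v ∷ʳ c) ++ v) pal ⟩
  (w ∷ʳ c) ++ w                   ≡⟨ ++-assoc w [ c ] w ⟩
  w ++ c ∷ w                      ∎
  where open ≡-Reasoning

⊙-++ : ∀ {A : Set} (xs ys : List A) (w : Word∞ A) t → ((xs ++ ys) ⊙ w) t ≡ (xs ⊙ (ys ⊙ w)) t
⊙-++ []       ys w t       = refl
⊙-++ (x ∷ xs) ys w zero    = refl
⊙-++ (x ∷ xs) ys w (suc t) = ⊙-++ xs ys w t

⊙-drop : ∀ {A : Set} (xs : List A) (w : Word∞ A) t → (xs ⊙ w) (length xs + t) ≡ w t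
⊙-drop []       w t = refl
⊙-drop (x ∷ xs) w t = ⊙-drop xs w t

⊙-lookup : ∀ {A : Set} (xs : List A) (w : Word∞ A) (i : Fin (length xs)) →
  (xs ⊙ w) (toℕ i) ≡ lookup xs i
⊙-lookup (x ∷ xs) w Fin.zero    = refl
⊙-lookup (x ∷ xs) w (Fin.suc i) = ⊙-lookup xs w i

⊙-All : ∀ {A : Set} {P : A → Set} {xs} (w : Word∞ A) {t} →
  All P xs → t < length xs → P ((xs ⊙ w) t)
⊙-All w {zero}  (px ∷ _)   _         = px
⊙-All w {suc t} (_  ∷ pxs) (s≤s t<n) = ⊙-All w pxs t<n

⊙-injective : ∀ {A : Set} {xs : List A} (w : Word∞ A) {t t'} → Unique xs →
  t < length xs → t' < length xs → (xs ⊙ w) t ≡ (xs ⊙ w) t' → t ≡ t'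
⊙-injective w {zero}  {zero}   _          _         _          _  = refl
⊙-injective w {zero}  {suc t'} (x≢ ∷ _)   _         (s≤s t'<n) eq = contradiction eq (⊙-All w x≢ t'<n)
⊙-injective w {suc t} {zero}   (x≢ ∷ _)   (s≤s t<n) _          eq =
  contradiction (sym eq) (⊙-All w x≢ t<n)
⊙-injective w {suc t} {suc t'} (_ ∷ uniq) (s≤s t<n) (s≤s t'<n) eq =
  cong suc (⊙-injective w uniq t<n t'<n eq)

Avoids : {A : Set} → A → Word∞ A → ℕ → ℕ → Set
Avoids c x q n = ∀ t → t < n → x (q + t) ≢ c

Avoids-extend : ∀ {A : Set} {c : A} {x q n} →
  Avoids c x q n → x (q + n) ≢ c → Avoids c x q (suc n)
Avoids-extend avoid last t t<1+n with m<1+n⇒m<n∨m≡n t<1+n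
... | inj₁ t<n  = avoid t t<n
... | inj₂ refl = last

count-takeω-≡0 : ∀ {k} {b : Fin k} {x n} → Avoids b x 0 n → count b (takeω n x) ≡ 0
count-takeω-≡0 {b = b} {x} {n} avoid = begin
  count b (takeω n x)                     ≡⟨ cong (count b) (takeω≡applyUpTo n x) ⟩
  length (filter (b ≟_) (applyUpTo x n))  ≡⟨ cong length (filter-none (b ≟_) none) ⟩
  0                                       ∎
  where
  open ≡-Reasoning
  none = applyUpTo⁺₁ x n λ t<n → avoid _ t<n ∘ sym

count-takeω-≥2 : ∀ {k} {b : Fin k} {x} n →
  x 0 ≡ b → x (suc n) ≡ b → 2 ≤ count b (takeω (suc (suc n)) x)
count-takeω-≥2 {b = b} {x} n x₀≡b x₁₊ₙ≡b =
  subst (2 ≤_) (sym (cong length (filter-accept (b ≟_) (sym x₀≡b))))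
    (s≤s (subst (λ v → 0 < length (filter (b ≟_) v)) (sym (takeω≡applyUpTo (suc n) (x ∘ suc)))
      (filter-some (b ≟_) (applyUpTo⁺ (x ∘ suc) (sym x₁₊ₙ≡b) (n<1+n n)))))

balanced⇒¬Avoids : ∀ {k} {s : Word∞ (Fin k)} {b e n q} → Balanced s →
  s e ≡ b → s (e + suc n) ≡ b → ¬ Avoids b s q (suc (suc n))
balanced⇒¬Avoids {s = s} {b} {e} {n} {q} balanced sₑ≡b sₑ₊₁₊ₙ≡b avoid = <⇒≱ two-at-e (begin
  count-at e                        ≡⟨ ∣-∣-identityʳ _ ⟨
  ∣ count-at e - 0 ∣                ≡⟨ cong (∣ count-at e -_∣) none-at-q ⟨
  ∣ count-at e - count-at q ∣       ≤⟨ balanced e q (suc (suc n)) b ⟩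
  1                                 ∎)
  where
  open ≤-Reasoning
  count-at : ℕ → ℕ
  count-at p = count b (factor s p (suc (suc n)))
  two-at-e : 2 ≤ count-at e
  two-at-e =
    count-takeω-≥2 {x = λ t → s (e + t)} n (trans (cong s (+-identityʳ e)) sₑ≡b) sₑ₊₁₊ₙ≡b
  none-at-q : count-at q ≡ 0
  none-at-q = count-takeω-≡0 {x = λ t → s (q + t)} avoid

either-≢ : ∀ {k} {x y : Fin k} → x ≢ y → ∀ c → x ≢ c ⊎ y ≢ c
either-≢ {x = x} x≢y c with x ≟ c
... | no x≢c  = inj₁ x≢c
... | yes refl = inj₂ (x≢y ∘ sym)

third-letter : ∀ {k} {s : Word∞ (Fin k)} → AtLeastThreeLetters s →
  ∀ a b → ∃ λ p → s p ≢ a × s p ≢ b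
third-letter {s = s} (p , q , r , p≢q , p≢r , q≢r) a b
  with s p ≟ a | s p ≟ b | either-≢ q≢r a | either-≢ q≢r b
... | no p≢a   | no p≢b   | _        | _        = p , p≢a , p≢b
... | yes refl | _        | _        | inj₁ q≢b = q , p≢q ∘ sym , q≢b
... | yes refl | _        | _        | inj₂ r≢b = r , p≢r ∘ sym , r≢b
... | no _     | yes refl | inj₁ q≢a | _        = q , q≢a , p≢q ∘ sym
... | no _     | yes refl | inj₂ r≢a | _        = r , r≢a , p≢r ∘ sym

mirror-below : ∀ {n t t'} → n < t → suc (t + t') ≤ suc (n + n) → t' < n
mirror-below {n} {t} {t'} n<t bound = +-cancelˡ-≤ n (suc t') n (begin
  n + suc t'  ≡⟨ +-suc n t' ⟩
  suc n + t'  ≤⟨ +-monoˡ-≤ t' n<t ⟩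
  t + t'      ≤⟨ s≤s⁻¹ bound ⟩
  n + n       ∎)
  where open ≤-Reasoning

module Directive {A : Set} {Δ s : Word∞ A} (directive : IsDirective Δ s) where

  u : ℕ → List A
  u = proj₁ directive

  ℓ : ℕ → ℕ
  ℓ n = length (u n)

  private
    u-zero : u 0 ≡ []
    u-zero = proj₁ (proj₂ directive)

    closure : ∀ n → IsPalClosure (u n ++ [ Δ n ]) (u (suc n))
    closure = proj₁ (proj₂ (proj₂ directive))

    u≡takeω : ∀ n → u n ≡ takeω (ℓ n) s
    u≡takeω = proj₂ (proj₂ (proj₂ directive))

    u-palindrome : ∀ n → Palindrome (u n)
    u-palindrome zero    = subst Palindrome (sym u-zero) refl
    u-palindrome (suc n) = proj₁ (closure n)

  ℓ-zero : ℓ 0 ≡ 0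
  ℓ-zero = cong length u-zero

  mirror : ∀ n {t t'} → suc (t + t') ≡ ℓ n → s t ≡ s t'
  mirror n {t} {t'} =
    palindrome-mirror {x = s} {t = t} {t'} (subst Palindrome (u≡takeω n) (u-palindrome n))

  s[ℓ]≡Δ : ∀ n → s (ℓ n) ≡ Δ n
  s[ℓ]≡Δ n = takeω≡++∷⇒letter {x = s} (u n) (begin
    takeω (ℓ (suc n)) s  ≡⟨ u≡takeω (suc n) ⟨
    u (suc n)            ≡⟨ proj₂ (proj₁ (proj₂ (closure n))) ⟨
    (u n ∷ʳ Δ n) ++ _    ≡⟨ ++-assoc (u n) [ Δ n ] _ ⟩
    u n ++ Δ n ∷ _       ∎)
    where open ≡-Reasoning

  ℓ-<-suc : ∀ n → ℓ n < ℓ (suc n)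
  ℓ-<-suc n = subst (ℓ n <_) (cong length extension) (begin-strict
    ℓ n                            <⟨ m<m+n (ℓ n) (s≤s z≤n) ⟩
    ℓ n + suc (length r)           ≡⟨ length-++ (u n) ⟨
    length (u n ++ Δ n ∷ r)        ≡⟨ cong length (++-assoc (u n) [ Δ n ] r) ⟨
    length ((u n ∷ʳ Δ n) ++ r)     ∎)
    where
    open ≤-Reasoning
    r = proj₁ (proj₁ (proj₂ (closure n)))
    extension = proj₂ (proj₁ (proj₂ (closure n)))

  ℓ-suc-≤ : ∀ n → ℓ (suc n) ≤ suc (ℓ n + ℓ n)
  ℓ-suc-≤ n = subst (ℓ (suc n) ≤_) (trans (length-++ (u n)) (+-suc (ℓ n) (ℓ n)))
    (proj₂ (proj₂ (closure n)) (u n ++ Δ n ∷ u n) (palindrome-++-∷ (Δ n) (u-palindrome n))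
      (u n , ++-assoc (u n) [ Δ n ] (u n)))

  n≤ℓ : ∀ n → n ≤ ℓ n
  n≤ℓ zero    = z≤n
  n≤ℓ (suc n) = ≤-trans (s≤s (n≤ℓ n)) (ℓ-<-suc n)

  ℓ-mono-≤ : ∀ {m n} → m ≤ n → ℓ m ≤ ℓ n
  ℓ-mono-≤ {n = zero}  z≤n = ≤-refl
  ℓ-mono-≤ {n = suc n} m≤1+n with m≤n⇒m<n∨m≡n m≤1+n
  ... | inj₁ m<1+n = ≤-trans (ℓ-mono-≤ (s≤s⁻¹ m<1+n)) (<⇒≤ (ℓ-<-suc n))
  ... | inj₂ refl  = ≤-refl

  ℓ-one : ℓ 1 ≡ 1
  ℓ-one = ≤-antisym (subst (λ n → ℓ 1 ≤ suc (n + n)) ℓ-zero (ℓ-suc-≤ 0))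
                    (subst (_< ℓ 1) ℓ-zero (ℓ-<-suc 0))

  s₀≡Δ₀ : s 0 ≡ Δ 0
  s₀≡Δ₀ = subst (λ t → s t ≡ Δ 0) ℓ-zero (s[ℓ]≡Δ 0)

  s₁≡Δ₁ : s 1 ≡ Δ 1
  s₁≡Δ₁ = subst (λ t → s t ≡ Δ 1) ℓ-one (s[ℓ]≡Δ 1)

  Absent : A → ℕ → Set
  Absent c n = Avoids c s 0 (ℓ n)

  absent-suc : ∀ {c} n → Absent c n → Δ n ≢ c → Absent c (suc n)
  absent-suc n absent Δₙ≢c t t<ℓ with <-cmp t (ℓ n)
  ... | tri< t<ℓₙ _ _ = absent t t<ℓₙ
  ... | tri≈ _ refl _ = Δₙ≢c ∘ trans (sym (s[ℓ]≡Δ n))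
  ... | tri> _ _ ℓₙ<t with m≤n⇒∃[o]m+o≡n t<ℓ
  ...   | t' , t+t'≡ = absent t' (mirror-below ℓₙ<t (≤-trans (≤-reflexive t+t'≡) (ℓ-suc-≤ n)))
                         ∘ trans (sym (mirror (suc n) t+t'≡))

  absent-induction : ∀ {c} n → (∀ i → i < n → Absent c i → Δ i ≢ c) → Absent c n
  absent-induction zero    _     t t<ℓ₀ = contradiction (subst (t <_) ℓ-zero t<ℓ₀) λ ()
  absent-induction (suc n) never = absent-suc n absent (never n (n<1+n n) absent)
    where absent = absent-induction n (λ i i<n → never i (m<n⇒m<1+n i<n))

  ℓ-suc-new : ∀ n → Absent (Δ n) n → ℓ (suc n) ≡ suc (ℓ n + ℓ n)
  ℓ-suc-new n new with m≤n⇒∃[o]m+o≡n (ℓ-<-suc n)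
  ... | t' , ℓ+t'≡ =
    ≤-antisym (ℓ-suc-≤ n) (subst (suc (ℓ n + ℓ n) ≤_) ℓ+t'≡ (s≤s (+-monoʳ-≤ (ℓ n) ℓ≤t')))
    where
    ℓ≤t' : ℓ n ≤ t'
    ℓ≤t' = ≮⇒≥ λ t'<ℓ → new t' t'<ℓ (trans (sym (mirror (suc n) ℓ+t'≡)) (s[ℓ]≡Δ n))

  copy-after-new : ∀ n → Absent (Δ n) n → ∀ {t} → t < ℓ n → s (suc (ℓ n + t)) ≡ s t
  copy-after-new n new {t} t<ℓ with m≤n⇒∃[o]m+o≡n t<ℓ
  ... | t' , t+t'≡ = trans (mirror (suc n) mirrored) (sym (mirror n t+t'≡))
    where
    open ≡-Reasoning
    mirrored : suc (suc (ℓ n + t) + t') ≡ ℓ (suc n)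
    mirrored = begin
      suc (suc (ℓ n + t + t'))   ≡⟨ cong (suc ∘ suc) (+-assoc (ℓ n) t t') ⟩
      suc (suc (ℓ n + (t + t'))) ≡⟨ cong suc (+-suc (ℓ n) (t + t')) ⟨
      suc (ℓ n + suc (t + t'))   ≡⟨ cong (λ m → suc (ℓ n + m)) t+t'≡ ⟩
      suc (ℓ n + ℓ n)            ≡⟨ ℓ-suc-new n new ⟨
      ℓ (suc n)                  ∎

  Absent⇒Avoids-suffix : ∀ {c i n d} → Absent c i → d + ℓ i ≡ ℓ n → Avoids c s d (ℓ i)
  Absent⇒Avoids-suffix {i = i} {n} {d} absent d+ℓᵢ≡ℓₙ t t<ℓ with m≤n⇒∃[o]m+o≡n t<ℓ
  ... | t' , t+t'≡ =
    absent t' (subst (t' <_) t+t'≡ (s≤s (m≤n+m t' t))) ∘ trans (sym (mirror n mirrored))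
    where
    open ≡-Reasoning
    mirrored : suc (d + t + t') ≡ ℓ n
    mirrored = begin
      suc (d + t + t')    ≡⟨ cong suc (+-assoc d t t') ⟩
      suc (d + (t + t'))  ≡⟨ +-suc d (t + t') ⟨
      d + suc (t + t')    ≡⟨ cong (d +_) t+t'≡ ⟩
      d + ℓ i             ≡⟨ d+ℓᵢ≡ℓₙ ⟩
      ℓ n                 ∎

  repeat-factor : ∀ {i n} → i < n → Δ i ≡ Δ n →
    ∃ λ e → s e ≡ Δ i × s (e + suc (ℓ i)) ≡ Δ i
  repeat-factor {i} {n} i<n Δᵢ≡Δₙ
    with m≤n⇒∃[o]m+o≡n (ℓ-<-suc n) | m≤n⇒∃[o]m+o≡n (<-≤-trans (ℓ-<-suc i) (ℓ-mono-≤ i<n))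
  ... | e , ℓₙ+e≡ | d , ℓᵢ+d≡ =
    e , sₑ≡Δᵢ , trans (mirror (suc n) mirrored) (trans (sym (mirror n ℓᵢ+d≡)) (s[ℓ]≡Δ i))
    where
    open ≡-Reasoning
    sₑ≡Δᵢ : s e ≡ Δ i
    sₑ≡Δᵢ = trans (sym (mirror (suc n) ℓₙ+e≡)) (trans (s[ℓ]≡Δ n) (sym Δᵢ≡Δₙ))
    mirrored : suc (e + suc (ℓ i) + d) ≡ ℓ (suc n)
    mirrored = begin
      suc (e + suc (ℓ i) + d)    ≡⟨ cong suc (+-assoc e (suc (ℓ i)) d) ⟩
      suc (e + suc (ℓ i + d))    ≡⟨ cong (λ m → suc (e + m)) ℓᵢ+d≡ ⟩
      suc (e + ℓ n)              ≡⟨ cong suc (+-comm e (ℓ n)) ⟩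
      suc (ℓ n + e)              ≡⟨ ℓₙ+e≡ ⟩
      ℓ (suc n)                  ∎

module RepeatedLetter {k : ℕ} {s : Word∞ (Fin k)} (balanced : Balanced s)
  {a : Fin k} {y : List (Fin k)} {z : Word∞ (Fin k)} (unique : Unique (a ∷ y))
  (directive : IsDirective ((a ∷ y ++ [ a ]) ⊙ z) s)
  (j : Fin (length y)) {i : ℕ} (zᵢ≡yⱼ : z i ≡ lookup y j) where

  D : Word∞ (Fin k)
  D = (a ∷ y ++ [ a ]) ⊙ z

  open Directive {Δ = D} {s = s} directive

  m : ℕ
  m = length y

  b : Fin k
  b = lookup y j

  J : ℕ
  J = suc (toℕ j)

  J≤m : J ≤ m
  J≤m = toℕ<n j

  D-injective : ∀ {t t'} → t ≤ m → t' ≤ m → D t ≡ D t' → t ≡ t'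
  D-injective {t} {t'} t≤m t'≤m Dₜ≡Dₜ' = ⊙-injective ([ a ] ⊙ z) unique (s≤s t≤m) (s≤s t'≤m)
    (trans (sym (⊙-++ (a ∷ y) [ a ] z t)) (trans Dₜ≡Dₜ' (⊙-++ (a ∷ y) [ a ] z t')))

  D[J]≡b : D J ≡ b
  D[J]≡b = trans (⊙-++ y [ a ] z (toℕ j)) (⊙-lookup y ([ a ] ⊙ z) j)

  D[1+m]≡a : D (suc m) ≡ a
  D[1+m]≡a = trans (⊙-++ y [ a ] z m)
    (trans (cong (y ⊙ ([ a ] ⊙ z)) (sym (+-identityʳ m))) (⊙-drop y ([ a ] ⊙ z) 0))

  D[2+m+i]≡b : D (suc (m + suc i)) ≡ b
  D[2+m+i]≡b =
    trans (⊙-++ y [ a ] z (m + suc i)) (trans (⊙-drop y ([ a ] ⊙ z) (suc i)) zᵢ≡yⱼ)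

  a≢b : a ≢ b
  a≢b a≡b = 0≢1+n (D-injective z≤n J≤m (trans a≡b (sym D[J]≡b)))

  D-new : ∀ {t} → t ≤ m → Absent (D t) t
  D-new {t} t≤m = absent-induction t λ t' t'<t _ Dₜ'≡Dₜ →
    <⇒≢ t'<t (D-injective (≤-trans (<⇒≤ t'<t) t≤m) t≤m Dₜ'≡Dₜ)

  b-new : Absent b J
  b-new = subst (λ c → Absent c J) D[J]≡b (D-new J≤m)

  ¬b-free-window : ∀ q → Avoids b s q (ℓ J) → s (q + ℓ J) ≢ b → s (q + suc (ℓ J)) ≢ b → ⊥
  ¬b-free-window q avoid at-ℓ at-ℓ+1
    with repeat-factor (s≤s (≤-trans J≤m (m≤m+n m (suc i)))) (trans D[J]≡b (sym D[2+m+i]≡b))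
  ... | e , sₑ≡ , sₑ₊≡ = balanced⇒¬Avoids {s = s} balanced (trans sₑ≡ D[J]≡b) (trans sₑ₊≡ D[J]≡b)
    (Avoids-extend {x = s} {q} (Avoids-extend {x = s} {q} avoid at-ℓ) at-ℓ+1)

  no-new-letter-after-J : ∀ {n} → J ≤ n → D n ≢ b → Absent (D n) n → ⊥
  no-new-letter-after-J {n} J≤n Dₙ≢b new with m≤n⇒∃[o]m+o≡n (ℓ-mono-≤ J≤n)
  ... | d , ℓ+d≡ = ¬b-free-window d (Absent⇒Avoids-suffix b-new d+ℓ≡) at-ℓₙ after-ℓₙ
    where
    open ≡-Reasoning
    d+ℓ≡ : d + ℓ J ≡ ℓ n
    d+ℓ≡ = trans (+-comm d (ℓ J)) ℓ+d≡
    at-ℓₙ : s (d + ℓ J) ≢ b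
    at-ℓₙ = Dₙ≢b ∘ trans (sym (trans (cong s d+ℓ≡) (s[ℓ]≡Δ n)))
    0<ℓₙ : 0 < ℓ n
    0<ℓₙ = ≤-trans (s≤s z≤n) (≤-trans J≤n (n≤ℓ n))
    after-ℓₙ : s (d + suc (ℓ J)) ≢ b
    after-ℓₙ = a≢b ∘ trans (sym (begin
      s (d + suc (ℓ J))   ≡⟨ cong s (+-suc d (ℓ J)) ⟩
      s (suc (d + ℓ J))   ≡⟨ cong (s ∘ suc) (trans d+ℓ≡ (sym (+-identityʳ (ℓ n)))) ⟩
      s (suc (ℓ n + 0))   ≡⟨ copy-after-new n new 0<ℓₙ ⟩
      s 0                 ≡⟨ s₀≡Δ₀ ⟩
      a                   ∎))

  J<m⇒⊥ : J < m → ⊥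
  J<m⇒⊥ J<m = no-new-letter-after-J (n≤1+n J) D[J+1]≢b (D-new J<m)
    where
    D[J+1]≢b : D (suc J) ≢ b
    D[J+1]≢b e = 1+n≢n (D-injective J<m J≤m (trans e (sym D[J]≡b)))

  1≡J⇒⊥ : AtLeastThreeLetters s → 1 ≡ J → ⊥
  1≡J⇒⊥ three 1≡J with third-letter three a b
  ... | p , sₚ≢a , sₚ≢b = absent (suc p) p (<-≤-trans (n<1+n p) (n≤ℓ (suc p))) refl
    where
    never-introduced : ∀ n → Absent (s p) n → D n ≢ s p
    never-introduced zero    _      D₀≡sₚ = sₚ≢a (sym D₀≡sₚ)
    never-introduced (suc n) absent Dₙ≡sₚ =
      no-new-letter-after-J (subst (_≤ suc n) 1≡J (s≤s z≤n)) (sₚ≢b ∘ trans (sym Dₙ≡sₚ))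
        (subst (λ c → Absent c (suc n)) (sym Dₙ≡sₚ) absent)
    absent : ∀ n → Absent (s p) n
    absent n = absent-induction n (λ i _ → never-introduced i)

  ℓ-suc-J : ℓ (suc J) ≡ suc (ℓ J + ℓ J)
  ℓ-suc-J = ℓ-suc-new J (D-new J≤m)

  shift-J : ∀ {t} → t < ℓ J → s (suc (ℓ J + t)) ≡ s t
  shift-J = copy-after-new J (D-new J≤m)

  b-only-at-ℓJ : ∀ {t} → t < ℓ (suc J) → s t ≡ b → t ≡ ℓ J
  b-only-at-ℓJ {t} t<ℓ sₜ≡b with <-cmp t (ℓ J)
  ... | tri< t<ℓJ _ _ = ⊥-elim (b-new t t<ℓJ sₜ≡b)
  ... | tri≈ _ t≡ℓJ _ = t≡ℓJ
  ... | tri> _ _ ℓJ<t with m≤n⇒∃[o]m+o≡n ℓJ<t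
  ...   | t₀ , refl = ⊥-elim (b-new t₀ t₀<ℓJ (trans (sym (shift-J t₀<ℓJ)) sₜ≡b))
    where
    t₀<ℓJ : t₀ < ℓ J
    t₀<ℓJ = +-cancelˡ-< (ℓ J) t₀ (ℓ J) (s≤s⁻¹ (subst (suc (ℓ J) + t₀ <_) ℓ-suc-J t<ℓ))

  s[2ℓJ+2]≡b⇒ℓ[J+2]≡3ℓJ+3 : s (suc (suc (ℓ J + ℓ J))) ≡ b →
    ℓ (suc (suc J)) ≡ suc (suc (suc (ℓ J + ℓ J)) + ℓ J)
  s[2ℓJ+2]≡b⇒ℓ[J+2]≡3ℓJ+3 s≡b
    with m≤n⇒m<n∨m≡n (subst (_< ℓ (suc (suc J))) ℓ-suc-J (ℓ-<-suc (suc J)))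
  ... | inj₂ 2ℓ+2≡ =
    ⊥-elim (1+n≢n (b-only-at-ℓJ ℓ+1<ℓ (trans (sym (mirror (suc (suc J)) mirrored)) sℓ≡b)))
    where
    mirrored : suc (ℓ J + suc (ℓ J)) ≡ ℓ (suc (suc J))
    mirrored = trans (cong suc (+-suc (ℓ J) (ℓ J))) 2ℓ+2≡
    sℓ≡b : s (ℓ J) ≡ b
    sℓ≡b = trans (s[ℓ]≡Δ J) D[J]≡b
    ℓ+1<ℓ : suc (ℓ J) < ℓ (suc J)
    ℓ+1<ℓ = subst (suc (ℓ J) <_) (sym ℓ-suc-J) (s≤s (m<m+n (ℓ J) (≤-trans (s≤s z≤n) (n≤ℓ J))))
  ... | inj₁ 2ℓ+2< with m≤n⇒∃[o]m+o≡n 2ℓ+2<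
  ...   | r , mirrored = subst (λ r → ℓ (suc (suc J)) ≡ suc (suc (suc (ℓ J + ℓ J)) + r))
                           (b-only-at-ℓJ r<ℓ sᵣ≡b) (sym mirrored)
    where
    r<ℓ : r < ℓ (suc J)
    r<ℓ = mirror-below (subst (_< suc (suc (ℓ J + ℓ J))) (sym ℓ-suc-J) (n<1+n _))
      (≤-trans (≤-reflexive mirrored) (ℓ-suc-≤ (suc J)))
    sᵣ≡b : s r ≡ b
    sᵣ≡b = trans (sym (mirror (suc (suc J)) mirrored)) s≡b

  s[2ℓJ+2]≢b : 2 ≤ J → s (suc (suc (ℓ J + ℓ J))) ≢ b
  s[2ℓJ+2]≢b 2≤J s≡b = contradiction (D-injective 1≤m z≤n D₁≡a) λ ()
    where
    open ≡-Reasoning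
    1≤m : 1 ≤ m
    1≤m = ≤-trans (s≤s z≤n) J≤m
    rearrange : ∀ l → suc (l + 1) + (l + l) ≡ suc (suc (l + l)) + l
    rearrange = solve-∀
    mirrored : suc (suc (ℓ J + 1) + (ℓ J + ℓ J)) ≡ ℓ (suc (suc J))
    mirrored = trans (cong suc (rearrange (ℓ J))) (sym (s[2ℓJ+2]≡b⇒ℓ[J+2]≡3ℓJ+3 s≡b))
    D₁≡a : D 1 ≡ a
    D₁≡a = begin
      D 1                ≡⟨ s₁≡Δ₁ ⟨
      s 1                ≡⟨ shift-J (≤-trans 2≤J (n≤ℓ J)) ⟨
      s (suc (ℓ J + 1))  ≡⟨ mirror (suc (suc J)) mirrored ⟩
      s (ℓ J + ℓ J)      ≡⟨ mirror (suc J) (trans (cong suc (+-identityʳ _)) (sym ℓ-suc-J)) ⟩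
      s 0                ≡⟨ s₀≡Δ₀ ⟩
      a                  ∎

  J≡m⇒⊥ : J ≡ m → 2 ≤ J → ⊥
  J≡m⇒⊥ J≡m 2≤J = ¬b-free-window (suc (ℓ J)) copy-of-u-J at-2ℓ+1 at-2ℓ+2
    where
    copy-of-u-J : Avoids b s (suc (ℓ J)) (ℓ J)
    copy-of-u-J t t<ℓ = b-new t t<ℓ ∘ trans (sym (shift-J t<ℓ))
    s[2ℓ+1]≡a : s (suc (ℓ J + ℓ J)) ≡ a
    s[2ℓ+1]≡a = trans (cong s (sym ℓ-suc-J))
      (trans (s[ℓ]≡Δ (suc J)) (subst (λ n → D (suc n) ≡ a) (sym J≡m) D[1+m]≡a))
    at-2ℓ+1 : s (suc (ℓ J) + ℓ J) ≢ b
    at-2ℓ+1 = a≢b ∘ trans (sym s[2ℓ+1]≡a)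
    at-2ℓ+2 : s (suc (ℓ J) + suc (ℓ J)) ≢ b
    at-2ℓ+2 = subst (λ t → s (suc t) ≢ b) (sym (+-suc (ℓ J) (ℓ J))) (s[2ℓJ+2]≢b 2≤J)

lemma3p7 : {k : ℕ} (s : Word∞ (Fin k)) →
    Balanced s → StandardEpisturmian s → AtLeastThreeLetters s →
    (a : Fin k) (y : List (Fin k)) (z : Word∞ (Fin k)) →
    length y ≥ 1 → Unique (a ∷ y) →
    IsDirective ((a ∷ y ++ [ a ]) ⊙ z) s →
    ∀ (i : ℕ) (j : Fin (length y)) → z i ≢ lookup y j
-- The unused hypotheses are implied: s is standard episturmian by the directive, and y ≠ [] since j exists.
lemma3p7 s balanced _ three a y z _ unique directive i j zᵢ≡yⱼ =
  cases (m≤n⇒m<n∨m≡n (s≤s z≤n)) (m≤n⇒m<n∨m≡n J≤m)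
  where
  open RepeatedLetter {s = s} balanced unique directive j zᵢ≡yⱼ
  cases : 1 < J ⊎ 1 ≡ J → J < m ⊎ J ≡ m → ⊥
  cases (inj₂ 1≡J) _          = 1≡J⇒⊥ three 1≡J
  cases (inj₁ 1<J) (inj₁ J<m) = J<m⇒⊥ J<m
  cases (inj₁ 1<J) (inj₂ J≡m) = J≡m⇒⊥ J≡m 1<J
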